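{- Suppose that $\mathbf{w}\in\{0,1,2\}^\omega$ contains no factor of exponent $\ge 5/2$, and that $\mathbf{w}=g(\mathbf{u})$ for some $\mathbf{u}\in\{0,1,2\}^\omega$, where $g=[a,b,c]$ (i.e. $g(0)=a,g(1)=b,g(2)=c$) with $a,b,c\in\{0,1,2\}^+$ such that: (i) $b$ is a prefix of $a$, which is a prefix of $c$; (ii) $|b|\ge|c|/2$; (iii) $b$ and $c$ have a common suffix $s$ with $|s|\ge|b|/2$. Then a final segment of $\mathbf{w}$ has the form $g(\gamma^2(\mathbf{v}))$ for some $\mathbf{v}\in\{0,1,2\}^\omega$; equivalently, a final segment of $\mathbf{w}$ has the form $g'(\mathbf{v})$ for some $\mathbf{v}\in\{0,1,2\}^\omega$, where $g'=c\,(g\circ\gamma^2)\,c^{ -1}=[cab,ca,caba]$. Moreover, letting $A=g'(0)$, $B=g'(1)$, $C=g'(2)$: (1) $B$ is a prefix of $A$, which is a prefix of $C$; (2) $|B|\ge|C|/2$; (3) $B$ and $C$ have a common suffix $S$ with $|S|\ge|B|/2$.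
   Context: $\gamma$ is the morphism $[01,2,02]$ on $\{0,1,2\}^*$, so $\gamma^2=[012,02,0102]$. The notation $g'=c\,(g\circ\gamma^2)\,c^{ -1}$ denotes the morphism $x\mapsto c\,g(\gamma^2(x))\,c^{ -1}$ (each $g(\gamma^2(x))$ ends in $c$). The exponent of a finite nonempty word with smallest period $p$ is its length divided by $p$. A final segment is an infinite suffix. -}

module Defs where

open import Data.Nat using (ℕ; zero; suc; _+_; _*_; _≤_; _<_)
open import Data.Fin using (Fin; zero; suc)
open import Data.List using (List; []; _∷_; _++_; length; concatMap; take)
open import Data.Product using (Σ; ∃; ∃-syntax; _×_; _,_)
open import Data.Unit using (⊤)
open import Data.Empty using (⊥)
open import Relation.Binary.PropositionalEquality using (_≡_)
open import Relation.Nullary using (¬_)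

Σ₃ : Set
Σ₃ = Fin 3

Word : Set
Word = List Σ₃

ωWord : Set
ωWord = ℕ → Σ₃

Morphism : Set
Morphism = Σ₃ → Word

[_,_,_] : Word → Word → Word → Morphism
[ a , b , c ] zero = a
[ a , b , c ] (suc zero) = b
[ a , b , c ] (suc (suc zero)) = c

apply : Morphism → Word → Word
apply g x = concatMap g x

_∘ₘ_ : Morphism → Morphism → Morphism
(g ∘ₘ h) x = apply g (h x)

0' 1' 2' : Σ₃
0' = zero
1' = suc zero
2' = suc (suc zero)

γ : Morphism
γ = [ 0' ∷ 1' ∷ [] , 2' ∷ [] , 0' ∷ 2' ∷ [] ]

γ² : Morphism
γ² = γ ∘ₘ γ

NonEmpty : Word → Set
NonEmpty [] = ⊥
NonEmpty (_ ∷ _) = ⊤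

PrefixOfω : Word → ωWord → Set
PrefixOfω [] w = ⊤
PrefixOfω (x ∷ xs) w = (x ≡ w 0) × PrefixOfω xs (λ n → w (suc n))

prefix : ℕ → ωWord → Word
prefix zero u = []
prefix (suc n) u = u 0 ∷ prefix n (λ k → u (suc k))

-- w = g(u) for an infinite word u: every g(u₀…u_{n-1}) is a prefix of w
-- (this determines w completely when all images g(x) are nonempty)
IsImage : Morphism → ωWord → ωWord → Set
IsImage g u w = ∀ n → PrefixOfω (apply g (prefix n u)) w

drop : ℕ → ωWord → ωWord
drop k w n = w (k + n)

IsPrefix : Word → Word → Set
IsPrefix x y = ∃[ t ] (y ≡ x ++ t)

IsSuffix : Word → Word → Set
IsSuffix s y = ∃[ t ] (y ≡ t ++ s)

IsPeriodOfFactor : ωWord → ℕ → ℕ → ℕ → Set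
IsPeriodOfFactor w i n p =
  (1 ≤ p) × (p ≤ n) × (∀ j → j + p < n → w (i + j) ≡ w (i + j + p))

IsSmallestPeriodOfFactor : ωWord → ℕ → ℕ → ℕ → Set
IsSmallestPeriodOfFactor w i n p =
  IsPeriodOfFactor w i n p × (∀ q → q < p → ¬ IsPeriodOfFactor w i n q)

HasFactorExp≥5/2 : ωWord → Set
HasFactorExp≥5/2 w =
  ∃[ i ] ∃[ n ] ∃[ p ] (1 ≤ n × IsSmallestPeriodOfFactor w i n p × 5 * p ≤ 2 * n)

{-# OPTIONS --safe #-}
module Submission where

-- If u contained one of the factors 00, 11, 22, 21 or 0101, then w = g(u) would contain aab, bbb, ccb,
-- cbb or ababa respectively (bbb again when 0101 is followed by 1). By (i)–(iii) each of these contains a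
-- word x x y with y a prefix of x and |x| ≤ 2|y|, i.e. of exponent ≥ 5/2; for cbb, writing c = r s and
-- b = r′ s, it is (s r′)(s r′) s. A word avoiding these factors splits, from its first 0 on, into the
-- blocks γ²(0) = 012, γ²(1) = 02, γ²(2) = 0102, so a final segment of w is a (g ∘ γ²)-image. As
-- g ∘ γ² = stem · c and g′ = c · stem with stem = [ab, a, aba], deleting the first stem-block of that
-- image leaves a g′-image. Conditions (1)–(3) for g′ are length arithmetic, with S = s a.

open import Defs
open import Data.Empty using (⊥-elim)
open import Data.Fin using (zero; suc)
open import Data.List using ([]; _∷_; _++_; length; concat; map)
open import Data.List.Properties
  using (length-++; length-++-comm; length-++-≤ˡ; ++-assoc; ++-identityʳ; ++-monoid; map-++; concat-++)
open import Data.Nat using (ℕ; zero; suc; _+_; _*_; _≤_; _<_; z≤n; s≤s)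
open import Data.Nat.Induction using (<-wellFounded)
open import Data.Nat.Properties
open import Data.Nat.Tactic.RingSolver using (solve-∀)
open import Data.Product using (∃; ∃-syntax; _×_; _,_; proj₁)
open import Data.Sum using (_⊎_; inj₁; inj₂)
open import Data.Unit using (tt)
open import Induction.WellFounded using (Acc; acc)
open import Relation.Binary.PropositionalEquality hiding ([_])
open import Relation.Nullary using (¬_)
open import Tactic.MonoidSolver using (solve)

private
  variable
    i j n p : ℕ
    W W′ u v w : ωWord
    x y z : Word
    f h : Morphism

PrefixOfω-resp : (∀ n → W n ≡ W′ n) → PrefixOfω x W → PrefixOfω x W′
PrefixOfω-resp {x = []}    W≗W′ _       = tt
PrefixOfω-resp {x = _ ∷ _} W≗W′ (e , p) = trans e (W≗W′ 0) , PrefixOfω-resp (λ n → W≗W′ (suc n)) p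

PrefixOfω-++⁻ˡ : ∀ x → PrefixOfω (x ++ y) W → PrefixOfω x W
PrefixOfω-++⁻ˡ []      _       = tt
PrefixOfω-++⁻ˡ (_ ∷ x) (e , p) = e , PrefixOfω-++⁻ˡ x p

PrefixOfω-++⁻ʳ : ∀ x → PrefixOfω (x ++ y) W → PrefixOfω y (drop (length x) W)
PrefixOfω-++⁻ʳ []      p       = p
PrefixOfω-++⁻ʳ (_ ∷ x) (_ , p) = PrefixOfω-++⁻ʳ x p

PrefixOfω-++⁺ : ∀ x → PrefixOfω x W → PrefixOfω y (drop (length x) W) → PrefixOfω (x ++ y) W
PrefixOfω-++⁺ []      _       q = q
PrefixOfω-++⁺ (_ ∷ x) (e , p) q = e , PrefixOfω-++⁺ x p q

PrefixOfω-drop-+ : PrefixOfω x (drop j (drop i w)) → PrefixOfω x (drop (i + j) w)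
PrefixOfω-drop-+ {j = j} {i} {w} = PrefixOfω-resp (λ n → cong w (sym (+-assoc i j n)))

PrefixOfω-drop-++⁻ʳ : ∀ x → PrefixOfω (x ++ y) (drop i w) → PrefixOfω y (drop (i + length x) w)
PrefixOfω-drop-++⁻ʳ {i = i} {w} x p = PrefixOfω-drop-+ {i = i} {w} (PrefixOfω-++⁻ʳ x p)

PrefixOfω-IsPrefix : IsPrefix x y → PrefixOfω y W → PrefixOfω x W
PrefixOfω-IsPrefix {x} (_ , refl) = PrefixOfω-++⁻ˡ x

PrefixOfω⇒≡prefix : PrefixOfω x W → x ≡ prefix (length x) W
PrefixOfω⇒≡prefix {[]}    _       = refl
PrefixOfω⇒≡prefix {_ ∷ _} (e , p) = cong₂ _∷_ e (PrefixOfω⇒≡prefix p)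

PrefixOfω-prefix : ∀ n → PrefixOfω (prefix n W) W
PrefixOfω-prefix zero    = tt
PrefixOfω-prefix (suc n) = refl , PrefixOfω-prefix n

PrefixOfω-agree : PrefixOfω x W → PrefixOfω x W′ → j < length x → W j ≡ W′ j
PrefixOfω-agree {_ ∷ _} {j = zero}  (e , _) (e′ , _) _         = trans (sym e) e′
PrefixOfω-agree {_ ∷ _} {j = suc _} (_ , p) (_ , p′) (s≤s j<∣x∣) = PrefixOfω-agree p p′ j<∣x∣

IsPrefix-refl : IsPrefix x x
IsPrefix-refl {x} = [] , sym (++-identityʳ x)

IsPrefix-++ˡ : ∀ x → IsPrefix y z → IsPrefix (x ++ y) (x ++ z)
IsPrefix-++ˡ {y} x (t , refl) = t , sym (++-assoc x y t)

IsPrefix-++ʳ : IsPrefix x y → IsPrefix x (y ++ z)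
IsPrefix-++ʳ {x} {z = z} (t , refl) = t ++ z , ++-assoc x t z

IsPrefix-trans : IsPrefix x y → IsPrefix y z → IsPrefix x z
IsPrefix-trans x≼y (t , refl) = IsPrefix-++ʳ x≼y

IsPrefix-length : IsPrefix x y → length x ≤ length y
IsPrefix-length {x} (t , refl) = subst (length x ≤_) (sym (length-++ x)) (m≤m+n _ _)

apply-++ : ∀ f x y → apply f (x ++ y) ≡ apply f x ++ apply f y
apply-++ f x y = trans (cong concat (map-++ f x y)) (sym (concat-++ (map f x) (map f y)))

apply-∘ : ∀ f h x → apply (f ∘ₘ h) x ≡ apply f (apply h x)
apply-∘ f h []      = refl
apply-∘ f h (z ∷ x) =
  trans (cong (apply f (h z) ++_) (apply-∘ f h x)) (sym (apply-++ f (h z) (apply h x)))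

prefix-+ : ∀ m n u → prefix (m + n) u ≡ prefix m u ++ prefix n (drop m u)
prefix-+ zero    n u = refl
prefix-+ (suc m) n u = cong (u 0 ∷_) (prefix-+ m n (λ k → u (suc k)))

IsImage-resp : (∀ n → W n ≡ W′ n) → IsImage f u W → IsImage f u W′
IsImage-resp W≗W′ img n = PrefixOfω-resp W≗W′ (img n)

IsImage-drop : IsImage f u W → ∀ m → IsImage f (drop m u) (drop (length (apply f (prefix m u))) W)
IsImage-drop {f} {u} {W} img m n =
  PrefixOfω-++⁻ʳ (apply f (prefix m u)) (subst (λ x → PrefixOfω x W) split (img (m + n)))
  where
  split : apply f (prefix (m + n) u) ≡ apply f (prefix m u) ++ apply f (prefix n (drop m u))
  split = trans (cong (apply f) (prefix-+ m n u)) (apply-++ f (prefix m u) _)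

IsImage-∘ : IsImage f u W → IsImage h v u → IsImage (f ∘ₘ h) v W
IsImage-∘ {f} {u} {W} {h} {v} fu hv n = subst (λ x → PrefixOfω x W) (sym through-u) (fu ∣hv∣)
  where
  ∣hv∣ : ℕ
  ∣hv∣ = length (apply h (prefix n v))
  through-u : apply (f ∘ₘ h) (prefix n v) ≡ apply f (prefix ∣hv∣ u)
  through-u = trans (apply-∘ f h (prefix n v)) (cong (apply f) (PrefixOfω⇒≡prefix (hv n)))

IsImage-conjugate : (P : Morphism) (c : Word) → (∀ z → h z ≡ P z ++ c) → (∀ z → f z ≡ c ++ P z) →
                    IsImage h v W → IsImage f (λ n → v (suc n)) (drop (length (P (v 0))) W)
IsImage-conjugate {h} {f} {v} {W} P c h≡Pc f≡cP img n =
  PrefixOfω-++⁻ˡ (apply f rest) (PrefixOfω-++⁻ʳ (P (v 0)) (subst (λ x → PrefixOfω x W) shift (img (suc n))))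
  where
  open ≡-Reasoning
  rest : Word
  rest = prefix n (λ k → v (suc k))
  commute : ∀ x → apply f x ++ c ≡ c ++ apply h x
  commute []      = sym (++-identityʳ c)
  commute (z ∷ x) = begin
    (f z ++ apply f x) ++ c       ≡⟨ ++-assoc (f z) (apply f x) c ⟩
    f z ++ apply f x ++ c         ≡⟨ cong₂ _++_ (f≡cP z) (commute x) ⟩
    (c ++ P z) ++ c ++ apply h x  ≡⟨ solve (++-monoid Σ₃) ⟩
    c ++ (P z ++ c) ++ apply h x  ≡⟨ cong (λ y → c ++ y ++ apply h x) (sym (h≡Pc z)) ⟩
    c ++ h z ++ apply h x         ∎
  shift : h (v 0) ++ apply h rest ≡ P (v 0) ++ apply f rest ++ c
  shift = begin
    h (v 0) ++ apply h rest         ≡⟨ cong (_++ apply h rest) (h≡Pc (v 0)) ⟩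
    (P (v 0) ++ c) ++ apply h rest  ≡⟨ ++-assoc (P (v 0)) c (apply h rest) ⟩
    P (v 0) ++ c ++ apply h rest    ≡⟨ cong (P (v 0) ++_) (sym (commute rest)) ⟩
    P (v 0) ++ apply f rest ++ c    ∎

conjugate-final-segment : (P : Morphism) (c : Word) → (∀ z → h z ≡ P z ++ c) → (∀ z → f z ≡ c ++ P z) →
                          ∃[ k ] ∃[ v ] IsImage h v (drop k w) → ∃[ k ] ∃[ v ] IsImage f v (drop k w)
conjugate-final-segment {w = w} P c h≡Pc f≡cP (k , v , img) =
  k + length (P (v 0)) , (λ n → v (suc n)) ,
  IsImage-resp (λ n → cong w (sym (+-assoc k (length (P (v 0))) n))) (IsImage-conjugate P c h≡Pc f≡cP img)

-- The smallest period of the factor is at most p, so its exponent is at least n / p.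
no-short-period : ¬ HasFactorExp≥5/2 w → IsPeriodOfFactor w i n p → ¬ (5 * p ≤ 2 * n)
no-short-period {w} {i} {n} {p} free = descend p (<-wellFounded p)
  where
  descend : ∀ p → Acc _<_ p → IsPeriodOfFactor w i n p → ¬ (5 * p ≤ 2 * n)
  descend p (acc smaller) per@(1≤p , p≤n , _) short =
    free (i , n , p , ≤-trans 1≤p p≤n , (per , shorter-periods) , short)
    where
    shorter-periods : ∀ q → q < p → ¬ IsPeriodOfFactor w i n q
    shorter-periods q q<p per′ = descend q (smaller q<p) per′ (≤-trans (*-monoʳ-≤ 5 (<⇒≤ q<p)) short)

m≤2n⇒5m≤2[m+n+m] : ∀ {m n} → m ≤ 2 * n → 5 * m ≤ 2 * (m + n + m)
m≤2n⇒5m≤2[m+n+m] {m} {n} m≤2n = subst₂ _≤_ (e₁ m) (e₂ m n) (+-monoʳ-≤ (4 * m) m≤2n)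
  where
  e₁ : ∀ m → 4 * m + m ≡ 5 * m
  e₁ = solve-∀
  e₂ : ∀ m n → 4 * m + 2 * n ≡ 2 * (m + n + m)
  e₂ = solve-∀

no-5/2-repetition : ¬ HasFactorExp≥5/2 w → ∀ i x → IsPrefix y x → 1 ≤ length x → length x ≤ 2 * length y →
                    ¬ PrefixOfω (x ++ x ++ y) (drop i w)
no-5/2-repetition {w} {y} free i x y≼x 1≤∣x∣ ∣x∣≤2∣y∣ xxy =
  no-short-period {w} {i} free (1≤∣x∣ , m≤n+m ∣x∣ ∣xy∣ , period) exponent≥5/2
  where
  ∣x∣ ∣xy∣ : ℕ
  ∣x∣ = length x
  ∣xy∣ = length (x ++ y)
  xy-at-0 : PrefixOfω (x ++ y) (drop i w)
  xy-at-0 = PrefixOfω-IsPrefix (IsPrefix-++ˡ x (IsPrefix-++ʳ y≼x)) xxy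
  xy-at-∣x∣ : PrefixOfω (x ++ y) (drop ∣x∣ (drop i w))
  xy-at-∣x∣ = PrefixOfω-++⁻ʳ x xxy
  period : ∀ j → j + ∣x∣ < ∣xy∣ + ∣x∣ → w (i + j) ≡ w (i + j + ∣x∣)
  period j j+∣x∣<n = trans (PrefixOfω-agree xy-at-0 xy-at-∣x∣ (+-cancelʳ-< ∣x∣ j ∣xy∣ j+∣x∣<n))
                           (cong w (trans (cong (i +_) (+-comm ∣x∣ j)) (sym (+-assoc i j ∣x∣))))
  exponent≥5/2 : 5 * ∣x∣ ≤ 2 * (∣xy∣ + ∣x∣)
  exponent≥5/2 = subst (λ l → 5 * ∣x∣ ≤ 2 * (l + ∣x∣)) (sym (length-++ x)) (m≤2n⇒5m≤2[m+n+m] ∣x∣≤2∣y∣)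

data Forbidden : Σ₃ → Σ₃ → Σ₃ → Σ₃ → Set where
  0·0     : ∀ {x y} → Forbidden 0' 0' x y
  1·1     : ∀ {x y} → Forbidden 1' 1' x y
  2·2     : ∀ {x y} → Forbidden 2' 2' x y
  2·1     : ∀ {x y} → Forbidden 2' 1' x y
  0·1·0·1 : Forbidden 0' 1' 0' 1'

AvoidsForbidden : ωWord → Set
AvoidsForbidden u = ∀ m → ¬ Forbidden (drop m u 0) (drop m u 1) (drop m u 2) (drop m u 3)

Forbidden-resp : ∀ {x₀ x₁ x₂ x₃ y₀ y₁ y₂ y₃} → x₀ ≡ y₀ → x₁ ≡ y₁ → x₂ ≡ y₂ → x₃ ≡ y₃ →
                 Forbidden x₀ x₁ x₂ x₃ → Forbidden y₀ y₁ y₂ y₃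
Forbidden-resp refl refl refl refl f = f

AvoidsForbidden-drop : AvoidsForbidden u → ∀ k → AvoidsForbidden (drop k u)
AvoidsForbidden-drop {u} ok k m f =
  ok (k + m) (Forbidden-resp (shift 0) (shift 1) (shift 2) (shift 3) f)
  where
  shift : ∀ j → u (k + (m + j)) ≡ u (k + m + j)
  shift j = cong u (sym (+-assoc k m j))

zero-in-window : ∀ {x₀ x₁ x₂ x₃ x₄} → ¬ Forbidden x₀ x₁ x₂ x₃ → ¬ Forbidden x₁ x₂ x₃ x₄ →
                 x₀ ≡ 0' ⊎ x₁ ≡ 0' ⊎ x₂ ≡ 0'
zero-in-window {zero}                                             _  _  = inj₁ refl
zero-in-window {suc zero}       {zero}                            _  _  = inj₂ (inj₁ refl)
zero-in-window {suc zero}       {suc zero}                        ¬f _  = ⊥-elim (¬f 1·1)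
zero-in-window {suc zero}       {suc (suc zero)} {zero}           _  _  = inj₂ (inj₂ refl)
zero-in-window {suc zero}       {suc (suc zero)} {suc zero}       _  ¬f = ⊥-elim (¬f 2·1)
zero-in-window {suc zero}       {suc (suc zero)} {suc (suc zero)} _  ¬f = ⊥-elim (¬f 2·2)
zero-in-window {suc (suc zero)} {zero}                            _  _  = inj₂ (inj₁ refl)
zero-in-window {suc (suc zero)} {suc zero}                        ¬f _  = ⊥-elim (¬f 2·1)
zero-in-window {suc (suc zero)} {suc (suc zero)}                  ¬f _  = ⊥-elim (¬f 2·2)

zero-occurs : AvoidsForbidden u → ∃[ m ] drop m u 0 ≡ 0'
zero-occurs ok with zero-in-window (ok 0) (ok 1)
... | inj₁ u₀≡0        = 0 , u₀≡0
... | inj₂ (inj₁ u₁≡0) = 1 , u₁≡0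
... | inj₂ (inj₂ u₂≡0) = 2 , u₂≡0

-- γ²(0) = 012, γ²(1) = 02 and γ²(2) = 0102 are told apart by the two letters after their initial 0.
nextBlock : Σ₃ → Σ₃ → Σ₃
nextBlock (suc (suc zero)) _                = 1'
nextBlock _                (suc (suc zero)) = 0'
nextBlock _                _                = 2'

γ²-block-window : ∀ {x₀ x₁ x₂ x₃ x₄ x₅ x₆} → x₀ ≡ 0' →
                  ¬ Forbidden x₀ x₁ x₂ x₃ → ¬ Forbidden x₁ x₂ x₃ x₄ →
                  ¬ Forbidden x₂ x₃ x₄ x₅ → ¬ Forbidden x₃ x₄ x₅ x₆ →
                  IsPrefix (γ² (nextBlock x₁ x₂) ++ 0' ∷ []) (x₀ ∷ x₁ ∷ x₂ ∷ x₃ ∷ x₄ ∷ [])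
γ²-block-window {x₁ = zero} refl ¬f _ _ _ = ⊥-elim (¬f 0·0)
γ²-block-window {x₁ = suc zero} {zero} {zero} refl _ _ ¬f _ = ⊥-elim (¬f 0·0)
γ²-block-window {x₁ = suc zero} {zero} {suc zero} refl ¬f _ _ _ = ⊥-elim (¬f 0·1·0·1)
γ²-block-window {x₁ = suc zero} {zero} {suc (suc zero)} {zero} refl _ _ _ _ = [] , refl
γ²-block-window {x₁ = suc zero} {zero} {suc (suc zero)} {suc zero} refl _ _ _ ¬f = ⊥-elim (¬f 2·1)
γ²-block-window {x₁ = suc zero} {zero} {suc (suc zero)} {suc (suc zero)} refl _ _ _ ¬f = ⊥-elim (¬f 2·2)
γ²-block-window {x₁ = suc zero} {suc zero} refl _ ¬f _ _ = ⊥-elim (¬f 1·1)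
γ²-block-window {x₁ = suc zero} {suc (suc zero)} {zero} {x₄} refl _ _ _ _ = x₄ ∷ [] , refl
γ²-block-window {x₁ = suc zero} {suc (suc zero)} {suc zero} refl _ _ ¬f _ = ⊥-elim (¬f 2·1)
γ²-block-window {x₁ = suc zero} {suc (suc zero)} {suc (suc zero)} refl _ _ ¬f _ = ⊥-elim (¬f 2·2)
γ²-block-window {x₁ = suc (suc zero)} {zero} {x₃} {x₄} refl _ _ _ _ = x₃ ∷ x₄ ∷ [] , refl
γ²-block-window {x₁ = suc (suc zero)} {suc zero} refl _ ¬f _ _ = ⊥-elim (¬f 2·1)
γ²-block-window {x₁ = suc (suc zero)} {suc (suc zero)} refl _ ¬f _ _ = ⊥-elim (¬f 2·2)

γ²-block : AvoidsForbidden u → u 0 ≡ 0' → PrefixOfω (γ² (nextBlock (u 1) (u 2)) ++ 0' ∷ []) u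
γ²-block {u} ok u₀≡0 =
  PrefixOfω-IsPrefix (γ²-block-window u₀≡0 (ok 0) (ok 1) (ok 2) (ok 3)) (PrefixOfω-prefix {u} 5)

blockLength : ωWord → ℕ
blockLength u = length (γ² (nextBlock (u 1) (u 2)))

blocks : ωWord → ωWord
blocks u zero    = nextBlock (u 1) (u 2)
blocks u (suc n) = blocks (drop (blockLength u) u) n

blocks-image : AvoidsForbidden u → u 0 ≡ 0' → IsImage γ² (blocks u) u
blocks-image ok u₀≡0 zero = tt
blocks-image {u} ok u₀≡0 (suc n) =
  PrefixOfω-++⁺ block (PrefixOfω-++⁻ˡ block block-then-0)
                (blocks-image (AvoidsForbidden-drop {u} ok (blockLength u)) next≡0 n)
  where
  block : Word
  block = γ² (nextBlock (u 1) (u 2))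
  block-then-0 : PrefixOfω (block ++ 0' ∷ []) u
  block-then-0 = γ²-block ok u₀≡0
  next≡0 : drop (blockLength u) u 0 ≡ 0'
  next≡0 = sym (proj₁ (PrefixOfω-++⁻ʳ block block-then-0))

NonEmpty⇒1≤length : NonEmpty x → 1 ≤ length x
NonEmpty⇒1≤length {_ ∷ _} _ = s≤s z≤n

Admissible : Word → Word → Word → Set
Admissible a b c = (IsPrefix b a × IsPrefix a c) × length c ≤ 2 * length b
                 × ∃[ s ] (IsSuffix s b × IsSuffix s c × length b ≤ 2 * length s)

module AdmissibleImage (w : ωWord) (free : ¬ HasFactorExp≥5/2 w) {a b c : Word} (1≤∣b∣ : 1 ≤ length b)
  (b≼a : IsPrefix b a) (a≼c : IsPrefix a c) (c≤2b : length c ≤ 2 * length b)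
  (s r r′ : Word) (b≡r′s : b ≡ r′ ++ s) (c≡rs : c ≡ r ++ s) (b≤2s : length b ≤ 2 * length s)
  where

  g : Morphism
  g = [ a , b , c ]

  b≼g : ∀ z → IsPrefix b (g z)
  b≼g zero             = b≼a
  b≼g (suc zero)       = IsPrefix-refl
  b≼g (suc (suc zero)) = IsPrefix-trans b≼a a≼c

  ∣b∣≤∣a∣ : length b ≤ length a
  ∣b∣≤∣a∣ = IsPrefix-length b≼a

  ∣a∣≤∣c∣ : length a ≤ length c
  ∣a∣≤∣c∣ = IsPrefix-length a≼c

  ¬aab : ∀ i → ¬ PrefixOfω (a ++ a ++ b) (drop i w)
  ¬aab i = no-5/2-repetition {w = w} free i a b≼a (≤-trans 1≤∣b∣ ∣b∣≤∣a∣) (≤-trans ∣a∣≤∣c∣ c≤2b)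

  ¬bbb : ∀ i → ¬ PrefixOfω (b ++ b ++ b) (drop i w)
  ¬bbb i = no-5/2-repetition {w = w} free i b IsPrefix-refl 1≤∣b∣ (m≤m+n (length b) (length b + 0))

  ¬ccb : ∀ i → ¬ PrefixOfω (c ++ c ++ b) (drop i w)
  ¬ccb i = no-5/2-repetition {w = w} free i c (b≼g 2') (≤-trans 1≤∣b∣ (≤-trans ∣b∣≤∣a∣ ∣a∣≤∣c∣)) c≤2b

  -- After its prefix r, the word c b b = r s r′ s r′ s reads (s r′) (s r′) s.
  ¬cbb : ∀ i → ¬ PrefixOfω (c ++ b ++ b) (drop i w)
  ¬cbb i cbb =
    no-5/2-repetition {w = w} free (i + length r) (s ++ r′) (IsPrefix-++ʳ IsPrefix-refl)
      (subst (1 ≤_) (sym ∣sr′∣≡∣b∣) 1≤∣b∣) (subst (_≤ 2 * length s) (sym ∣sr′∣≡∣b∣) b≤2s)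
      (PrefixOfω-IsPrefix ([] , shape)
        (PrefixOfω-drop-++⁻ʳ {i = i} {w} r (subst (λ t → PrefixOfω t (drop i w)) c-split cbb)))
    where
    ∣sr′∣≡∣b∣ : length (s ++ r′) ≡ length b
    ∣sr′∣≡∣b∣ = trans (length-++-comm s r′) (cong length (sym b≡r′s))
    c-split : c ++ b ++ b ≡ r ++ s ++ b ++ b
    c-split = trans (cong (_++ b ++ b) c≡rs) (++-assoc r s (b ++ b))
    shape : s ++ b ++ b ≡ ((s ++ r′) ++ (s ++ r′) ++ s) ++ []
    shape = trans (cong (λ t → s ++ t ++ t) b≡r′s) (solve (++-monoid Σ₃))

  ¬ababa : ∀ i → ¬ PrefixOfω (a ++ b ++ a ++ b ++ a) (drop i w)
  ¬ababa i ababa =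
    no-5/2-repetition {w = w} free i (a ++ b) (IsPrefix-++ʳ IsPrefix-refl)
      (≤-trans 1≤∣b∣ (≤-trans ∣b∣≤∣a∣ (length-++-≤ˡ a))) ∣ab∣≤2∣a∣
      (subst (λ t → PrefixOfω t (drop i w)) shape ababa)
    where
    ∣ab∣≤2∣a∣ : length (a ++ b) ≤ 2 * length a
    ∣ab∣≤2∣a∣ = subst (_≤ 2 * length a) (sym (length-++ a))
                      (+-monoʳ-≤ (length a) (≤-trans ∣b∣≤∣a∣ (m≤m+n (length a) 0)))
    shape : a ++ b ++ a ++ b ++ a ≡ (a ++ b) ++ (a ++ b) ++ a
    shape = solve (++-monoid Σ₃)

  b-follows : ∀ x y z {t} → PrefixOfω (x ++ y ++ g z ++ t) W → PrefixOfω (x ++ y ++ b) W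
  b-follows x y z = PrefixOfω-IsPrefix (IsPrefix-++ˡ x (IsPrefix-++ˡ y (IsPrefix-++ʳ (b≼g z))))

  a-follows-abab : IsPrefix a x → PrefixOfω (a ++ b ++ a ++ b ++ x ++ y) W → PrefixOfω (a ++ b ++ a ++ b ++ a) W
  a-follows-abab a≼x =
    PrefixOfω-IsPrefix (IsPrefix-++ˡ a (IsPrefix-++ˡ b (IsPrefix-++ˡ a (IsPrefix-++ˡ b (IsPrefix-++ʳ a≼x)))))

  forbidden-not-in-image : ∀ i {x₀ x₁ x₂ x₃} x₄ x₅ → Forbidden x₀ x₁ x₂ x₃ →
                           ¬ PrefixOfω (apply g (x₀ ∷ x₁ ∷ x₂ ∷ x₃ ∷ x₄ ∷ x₅ ∷ [])) (drop i w)
  forbidden-not-in-image i {x₂ = z} _ _ 0·0 img = ¬aab i (b-follows a a z img)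
  forbidden-not-in-image i {x₂ = z} _ _ 1·1 img = ¬bbb i (b-follows b b z img)
  forbidden-not-in-image i {x₂ = z} _ _ 2·2 img = ¬ccb i (b-follows c c z img)
  forbidden-not-in-image i {x₂ = z} _ _ 2·1 img = ¬cbb i (b-follows c b z img)
  forbidden-not-in-image i zero             _ 0·1·0·1 img = ¬ababa i (a-follows-abab IsPrefix-refl img)
  forbidden-not-in-image i (suc (suc zero)) _ 0·1·0·1 img = ¬ababa i (a-follows-abab a≼c img)
  forbidden-not-in-image i (suc zero)       z 0·1·0·1 img =
    ¬bbb (i + length a + length b + length a)
         (b-follows b b z (PrefixOfω-drop-++⁻ʳ {i = i + length a + length b} {w} a
                            (PrefixOfω-drop-++⁻ʳ {i = i + length a} {w} b
                              (PrefixOfω-drop-++⁻ʳ {i = i} {w} a img))))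

  image-avoids : IsImage g u w → AvoidsForbidden u
  image-avoids {u} img m f =
    forbidden-not-in-image (length (apply g (prefix m u))) (u (m + 4)) (u (m + 5)) f (IsImage-drop img m 6)

  γ²-desubstitution : IsImage g u w → ∃[ k ] ∃[ v ] IsImage (g ∘ₘ γ²) v (drop k w)
  γ²-desubstitution {u} img =
    let avoids     = image-avoids img
        (m , u₀≡0) = zero-occurs {u} avoids
    in  length (apply g (prefix m u)) , blocks (drop m u) ,
        IsImage-∘ (IsImage-drop img m) (blocks-image (AvoidsForbidden-drop {u} avoids m) u₀≡0)

stem : Word → Word → Morphism
stem a b = [ a ++ b , a , a ++ b ++ a ]

[a,b,c]∘γ²≡stem++c : ∀ a b c z → ([ a , b , c ] ∘ₘ γ²) z ≡ stem a b z ++ c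
[a,b,c]∘γ²≡stem++c a b c zero             = solve (++-monoid Σ₃)
[a,b,c]∘γ²≡stem++c a b c (suc zero)       = solve (++-monoid Σ₃)
[a,b,c]∘γ²≡stem++c a b c (suc (suc zero)) = solve (++-monoid Σ₃)

g′≡c++stem : ∀ a b c z → [ c ++ a ++ b , c ++ a , c ++ a ++ b ++ a ] z ≡ c ++ stem a b z
g′≡c++stem a b c zero             = refl
g′≡c++stem a b c (suc zero)       = refl
g′≡c++stem a b c (suc (suc zero)) = refl

Admissible-g′ : ∀ {a b c} → Admissible a b c → Admissible (c ++ a ++ b) (c ++ a) (c ++ a ++ b ++ a)
Admissible-g′ {a} {b} {c} ((b≼a , a≼c) , c≤2b , s , (r′ , b≡r′s) , (r , c≡rs) , b≤2s) =
    ((b , sym (++-assoc c a b)) , IsPrefix-++ˡ c (IsPrefix-++ˡ a (a , refl)))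
  , caba≤2ca
  , s ++ a , (r , ca≡r·sa) , (c ++ a ++ r′ , caba≡car′·sa) , ca≤2sa
  where
  open ≤-Reasoning
  ∣a∣ ∣b∣ ∣c∣ ∣s∣ : ℕ
  ∣a∣ = length a
  ∣b∣ = length b
  ∣c∣ = length c
  ∣s∣ = length s
  ca≡r·sa : c ++ a ≡ r ++ s ++ a
  ca≡r·sa = trans (cong (_++ a) c≡rs) (++-assoc r s a)
  caba≡car′·sa : c ++ a ++ b ++ a ≡ (c ++ a ++ r′) ++ s ++ a
  caba≡car′·sa = trans (cong (λ t → c ++ a ++ t ++ a) b≡r′s) (solve (++-monoid Σ₃))
  caba≤2ca : length (c ++ a ++ b ++ a) ≤ 2 * length (c ++ a)
  caba≤2ca = begin
    length (c ++ a ++ b ++ a)  ≡⟨ lengths ⟩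
    ∣c∣ + (∣a∣ + (∣b∣ + ∣a∣))    ≤⟨ +-monoʳ-≤ ∣c∣ (+-monoʳ-≤ ∣a∣ (+-monoˡ-≤ ∣a∣ ∣b∣≤∣c∣)) ⟩
    ∣c∣ + (∣a∣ + (∣c∣ + ∣a∣))    ≡⟨ double ∣c∣ ∣a∣ ⟩
    2 * (∣c∣ + ∣a∣)              ≡⟨ cong (2 *_) (sym (length-++ c)) ⟩
    2 * length (c ++ a)        ∎
    where
    ∣b∣≤∣c∣ : ∣b∣ ≤ ∣c∣
    ∣b∣≤∣c∣ = IsPrefix-length (IsPrefix-trans b≼a a≼c)
    lengths : length (c ++ a ++ b ++ a) ≡ ∣c∣ + (∣a∣ + (∣b∣ + ∣a∣))
    lengths = trans (length-++ c) (cong (∣c∣ +_) (trans (length-++ a) (cong (∣a∣ +_) (length-++ b))))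
    double : ∀ m n → m + (n + (m + n)) ≡ 2 * (m + n)
    double = solve-∀
  ca≤2sa : length (c ++ a) ≤ 2 * length (s ++ a)
  ca≤2sa = begin
    length (c ++ a)            ≡⟨ length-++ c ⟩
    ∣c∣ + ∣a∣                   ≤⟨ +-monoˡ-≤ ∣a∣ c≤2b ⟩
    2 * ∣b∣ + ∣a∣               ≡⟨ regroup ∣b∣ ∣a∣ ⟩
    ∣b∣ + (∣b∣ + ∣a∣)            ≤⟨ +-mono-≤ b≤2s (+-monoˡ-≤ ∣a∣ (IsPrefix-length b≼a)) ⟩
    2 * ∣s∣ + (∣a∣ + ∣a∣)        ≡⟨ spread ∣s∣ ∣a∣ ⟩
    2 * (∣s∣ + ∣a∣)              ≡⟨ cong (2 *_) (sym (length-++ s)) ⟩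
    2 * length (s ++ a)        ∎
    where
    regroup : ∀ m n → 2 * m + n ≡ m + (m + n)
    regroup = solve-∀
    spread : ∀ m n → 2 * m + (n + n) ≡ 2 * (m + n)
    spread = solve-∀

lemma2 : (w u : ωWord) (a b c : Word) →
         ¬ HasFactorExp≥5/2 w →
         NonEmpty a → NonEmpty b → NonEmpty c →
         IsImage [ a , b , c ] u w →
         IsPrefix b a → IsPrefix a c →
         length c ≤ 2 * length b →
         (∃[ s ] (IsSuffix s b × IsSuffix s c × length b ≤ 2 * length s)) →
         (∃[ k ] ∃[ v ] IsImage ([ a , b , c ] ∘ₘ γ²) v (drop k w))
         × (∃[ k ] ∃[ v ] IsImage [ c ++ a ++ b , c ++ a , c ++ a ++ b ++ a ] v (drop k w))
         × (IsPrefix (c ++ a) (c ++ a ++ b) × IsPrefix (c ++ a ++ b) (c ++ a ++ b ++ a))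
         × length (c ++ a ++ b ++ a) ≤ 2 * length (c ++ a)
         × (∃[ S ] (IsSuffix S (c ++ a) × IsSuffix S (c ++ a ++ b ++ a)
                    × length (c ++ a) ≤ 2 * length S))
lemma2 w u a b c free _ b-nonempty _ img b≼a a≼c c≤2b suffix@(s , (r′ , b≡r′s) , (r , c≡rs) , b≤2s) =
    g∘γ²-segment
  , conjugate-final-segment {w = w} (stem a b) c
      ([a,b,c]∘γ²≡stem++c a b c) (g′≡c++stem a b c) g∘γ²-segment
  , Admissible-g′ ((b≼a , a≼c) , c≤2b , suffix)
  where
  open AdmissibleImage w free (NonEmpty⇒1≤length b-nonempty) b≼a a≼c c≤2b s r r′ b≡r′s c≡rs b≤2s
  g∘γ²-segment : ∃[ k ] ∃[ v ] IsImage ([ a , b , c ] ∘ₘ γ²) v (drop k w)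
  g∘γ²-segment = γ²-desubstitution img
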